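{- Let $p$ be a prime and $n,k$ positive integers with $k<n$. Any nonadaptive classical deterministic algorithm solving the generalized Simon's problem $\mathsf{GSP}(p,n,k)$ must make $\Omega\left(\max\{k,\sqrt{k\cdot p^{n-k}}\}\right)$ queries to $f$.
   Context: $\mathbb{Z}_p^n$ is the additive group of $n$-tuples over $\mathbb{Z}_p$ with componentwise addition mod $p$; its subgroups are exactly the $\mathbb{F}_p$-linear subspaces, and the rank of a subgroup is its dimension. The problem $\mathsf{GSP}(p,n,k)$: one is given oracle access to an unknown function $f:\mathbb{Z}_p^n\to X$, where $X$ is a finite set, with the promise that there is a subgroup $S\le\mathbb{Z}_p^n$ of rank $k$ such that for all $x,y\in\mathbb{Z}_p^n$, $f(x)=f(y)$ iff $x-y\in S$; the goal is to output $S$. A query returns $f(x)$ for a chosen $x$. A deterministic algorithm must always output $S$ correctly; it is nonadaptive if the set of points it queries does not depend on the answers to previous queries. The implied constants in $\Omega$ are absolute. -}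

module Defs where

open import Data.Nat using (ℕ; zero; suc; _+_; _*_; _∸_; NonZero)
open import Data.Nat.DivMod using (_mod_)
open import Data.Fin using (Fin; toℕ)
open import Data.Vec using (Vec; lookup; tabulate; map; zipWith; replicate)
open import Data.Bool using (Bool; true)

open import Data.Product using (Σ; ∃; _×_)
open import Relation.Binary.PropositionalEquality using (_≡_)

sumFin : (k : ℕ) → (Fin k → ℕ) → ℕ
sumFin zero    g = 0
sumFin (suc k) g = g Fin.zero + sumFin k (λ i → g (Fin.suc i))

module _ (p : ℕ) .{{_ : NonZero p}} where

  _+ₚ_ : Fin p → Fin p → Fin p
  a +ₚ b = (toℕ a + toℕ b) mod p

  negₚ : Fin p → Fin p
  negₚ a = (p ∸ toℕ a) mod p

  zeroₚ : Fin p
  zeroₚ = 0 mod p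

  Point : ℕ → Set
  Point n = Vec (Fin p) n

  _⊕_ : ∀ {n} → Point n → Point n → Point n
  x ⊕ y = zipWith _+ₚ_ x y

  ⊖_ : ∀ {n} → Point n → Point n
  ⊖ x = map negₚ x

  _⊝_ : ∀ {n} → Point n → Point n → Point n
  x ⊝ y = x ⊕ (⊖ y)

  𝟎 : ∀ {n} → Point n
  𝟎 = replicate _ zeroₚ

  lincomb : ∀ {n k} → Vec (Fin p) k → Vec (Point n) k → Point n
  lincomb {n} {k} c b =
    tabulate (λ j → sumFin k (λ i → toℕ (lookup c i) * toℕ (lookup (lookup b i) j)) mod p)

  IsSubgroup : ∀ {n} → (Point n → Set) → Set
  IsSubgroup S = S 𝟎
               × (∀ x y → S x → S y → S (x ⊕ y))
               × (∀ x → S x → S (⊖ x))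

  HasRank : ∀ {n} → ℕ → (Point n → Set) → Set
  HasRank {n} k S = Σ (Vec (Point n) k) λ b →
      (∀ c c′ → lincomb c b ≡ lincomb c′ b → c ≡ c′)
    × (∀ x → (S x → ∃ λ c → lincomb c b ≡ x) × ((∃ λ c → lincomb c b ≡ x) → S x))

  Hides : ∀ {n} {X : Set} → (Point n → X) → (Point n → Set) → Set
  Hides f S = ∀ x y → (f x ≡ f y → S (x ⊝ y)) × (S (x ⊝ y) → f x ≡ f y)

  -- nonadaptive deterministic algorithm for GSP(p,n,k) with answer set X = Fin m:
  -- a fixed list of q query points, and an output map from the answers to a subset
  -- (given by its characteristic function) of ℤ_p^n
  record NonadaptiveAlg (n m : ℕ) : Set where
    field
      q       : ℕ
      queries : Vec (Point n) q
      output  : Vec (Fin m) q → Point n → Bool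

  open NonadaptiveAlg public

  Solves : ∀ {n m} → (k : ℕ) → NonadaptiveAlg n m → Set₁
  Solves {n} {m} k A =
    ∀ (S : Point n → Set) → IsSubgroup S → HasRank k S →
    ∀ (f : Point n → Fin m) → Hides f S →
    ∀ x → (output A (map f (queries A)) x ≡ true → S x)
        × (S x → output A (map f (queries A)) x ≡ true)

module Submission where

-- Write n = k + m.  For every k × m matrix A over ℤ_p the graph
-- S_A = {(u, u A)} is a rank-k subgroup hidden by hide A (u, w) = w - u A, whose
-- values lie in ℤ_p^m and so fit into any answer set of size ≥ p^m.
--   1. Indistinguishability: if hide A and hide A′ induce the same partition of
--      the query set, a relabelling of answers makes the algorithm see the same
--      answers, so it outputs S_A = S_A′ and A = A′.
--   2. Rank bound: hence A ↦ (hide A y_i)_i is injective, so p^(mk) ≤ p^(mq).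
--   3. Collision bound: A is even determined by which query differences y_i - y_j
--      (with nonzero ℤ_p^k-part) lie in S_A; each such difference lies in S_A for
--      at most p^(m(k-1)) matrices.  Markov's inequality on the number of these
--      collisions, plus a count of sparse Boolean vectors, gives k p^m ≤ 4 q².

open import Defs
open import Data.Nat using (ℕ; zero; suc; NonZero; _^_; _≤_; _<_; z≤n; s≤s; _≤ᵇ_)
import Data.Nat.Properties as ℕ
open import Data.Nat.Primality using (Prime)
open import Data.Bool using (Bool; true; false; not; _∧_; T)
open import Data.Bool.Properties using (∧-identityʳ)
open import Data.Empty using (⊥-elim)
open import Data.Fin as Fin using (Fin; zero; suc; toℕ; _↑ˡ_; _↑ʳ_; combine; remQuot; inject≤)
open import Data.Fin.Properties using (remQuot-combine; combine-remQuot; suc-injective; inject≤-injective; injective⇒≤)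
open import Data.Product using (_×_; _,_; ∃; ∃₂; proj₁; proj₂; swap)
open import Data.Sum using (_⊎_; inj₁; inj₂)
open import Data.Vec using (Vec; []; _∷_; lookup; tabulate; map; zipWith; replicate; take; drop; _++_)
open import Data.Vec.Properties
  using ( lookup-map; lookup-zipWith; lookup-replicate; lookup∘tabulate; tabulate∘lookup; tabulate-cong
        ; lookup-++ˡ; lookup-++ʳ; take-zipWith; drop-zipWith; take-map; drop-map; take++drop≡id
        ; ++-injective; ++-injectiveˡ; ≡-dec)
open import Relation.Nullary using (Dec; does; yes; no; ¬_)
open import Relation.Binary.Definitions using (DecidableEquality)
open import Relation.Binary.PropositionalEquality
open import Algebra.Properties.CommutativeMonoid.Sum ℕ.+-0-commutativeMonoid
  using (sum; sum-syntax; sum-cong-≗; ∑-distrib-+; ∑-comm)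

-- Arithmetic of ℤ_p, checked in ℤ.  We work with the congruence x ≈ y ⇔ p ∣ x - y
-- on ℤ: every operation of ℤ_p from Defs is shown to agree, up to ≈, with the
-- corresponding integer operation on canonical representatives ⟦ a ⟧, and
-- congruent canonical representatives are equal.  Every identity in ℤ_p then
-- follows from a ring identity in ℤ, normalised by the ring solver.
module Congruence (p : ℕ) .{{_ : NonZero p}} where

  open import Data.Nat using (_∸_; _%_; _/_) renaming (_+_ to _ℕ+_; _*_ to _ℕ*_)
  import Data.Nat.Divisibility as ℕ∣
  open import Data.Nat.DivMod using (_mod_; m≡m%n+[m/n]*n; m%n<n)
  open import Data.Nat.Primality using (euclidsLemma)
  open import Data.Integer using (ℤ; +_; -_; _+_; _-_; _*_; ∣_∣)
  import Data.Integer.Properties as ℤ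
  open import Data.Integer.Divisibility.Signed
    using (_∣_; divides; ∣m∣n⇒∣m+n; ∣m⇒∣-m; ∣n⇒∣m*n; ∣m⇒∣m*n; ∣⇒∣ᵤ; ∣ᵤ⇒∣)
  open import Data.Integer.Tactic.RingSolver using (solve-∀)
  open import Data.Fin.Properties using (toℕ-fromℕ<; toℕ<n; toℕ-injective)
  open import Level using (0ℓ)
  open import Relation.Binary.Bundles using (Setoid)
  import Relation.Binary.Reasoning.Setoid

  infix 4 _≈_
  record _≈_ (x y : ℤ) : Set where
    constructor mod-p
    field divides-difference : + p ∣ x - y

  ≈-via : ∀ {x y x′ y′} → x - y ≡ x′ - y′ → x ≈ y → x′ ≈ y′
  ≈-via eq (mod-p d) = mod-p (subst (+ p ∣_) eq d)

  ≡⇒≈ : ∀ {x y} → x ≡ y → x ≈ y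
  ≡⇒≈ {x} refl = mod-p (divides (+ 0) (ℤ.+-inverseʳ x))

  ≈-refl : ∀ {x} → x ≈ x
  ≈-refl = ≡⇒≈ refl

  ≈-sym : ∀ {x y} → x ≈ y → y ≈ x
  ≈-sym {x} {y} (mod-p d) = mod-p (subst (+ p ∣_) (identity x y) (∣m⇒∣-m d))
    where identity : ∀ x y → - (x - y) ≡ y - x
          identity = solve-∀

  ≈-trans : ∀ {x y z} → x ≈ y → y ≈ z → x ≈ z
  ≈-trans {x} {y} {z} (mod-p d) (mod-p d′) = mod-p (subst (+ p ∣_) (identity x y z) (∣m∣n⇒∣m+n d d′))
    where identity : ∀ x y z → (x - y) + (y - z) ≡ x - z
          identity = solve-∀

  +-cong : ∀ {x x′ y y′} → x ≈ x′ → y ≈ y′ → x + y ≈ x′ + y′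
  +-cong {x} {x′} {y} {y′} (mod-p d) (mod-p d′) =
    mod-p (subst (+ p ∣_) (identity x x′ y y′) (∣m∣n⇒∣m+n d d′))
    where identity : ∀ x x′ y y′ → (x - x′) + (y - y′) ≡ (x + y) - (x′ + y′)
          identity = solve-∀

  -‿cong : ∀ {x x′} → x ≈ x′ → - x ≈ - x′
  -‿cong {x} {x′} h = ≈-sym (≈-via (identity x x′) h)
    where identity : ∀ x x′ → x - x′ ≡ (- x′) - (- x)
          identity = solve-∀

  *-cong : ∀ {x x′ y y′} → x ≈ x′ → y ≈ y′ → x * y ≈ x′ * y′
  *-cong {x} {x′} {y} {y′} (mod-p d) (mod-p d′) =
    mod-p (subst (+ p ∣_) (identity x x′ y y′) (∣m∣n⇒∣m+n (∣n⇒∣m*n x d′) (∣m⇒∣m*n y′ d)))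
    where identity : ∀ x x′ y y′ → x * (y - y′) + (x - x′) * y′ ≡ x * y - x′ * y′
          identity = solve-∀

  ≈-setoid : Setoid 0ℓ 0ℓ
  ≈-setoid = record { Carrier = ℤ ; _≈_ = _≈_
                    ; isEquivalence = record { refl = ≈-refl ; sym = ≈-sym ; trans = ≈-trans } }

  module ≈-Reasoning = Relation.Binary.Reasoning.Setoid ≈-setoid

  ⟦_⟧ : Fin p → ℤ
  ⟦ a ⟧ = + toℕ a

  ⟦mod⟧ : ∀ m → ⟦ m mod p ⟧ ≈ + m
  ⟦mod⟧ m = ≈-sym (mod-p (divides (+ (m / p)) (begin
    + m - ⟦ m mod p ⟧                       ≡⟨ cong₂ (λ a b → + a - + b) (m≡m%n+[m/n]*n m p) (toℕ-fromℕ< (m%n<n m p)) ⟩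
    + (m % p ℕ+ m / p ℕ* p) - + (m % p)   ≡⟨ cong (_- + (m % p)) (trans (ℤ.pos-+ (m % p) _) (cong (λ t → + (m % p) + t) (ℤ.pos-* (m / p) p))) ⟩
    (+ (m % p) + + (m / p) * + p) - + (m % p) ≡⟨ identity (+ (m % p)) (+ (m / p) * + p) ⟩
    + (m / p) * + p                          ∎)))
    where open ≡-Reasoning
          identity : ∀ r s → (r + s) - r ≡ s
          identity = solve-∀

  ⟦+ₚ⟧ : ∀ a b → ⟦ _+ₚ_ p a b ⟧ ≈ ⟦ a ⟧ + ⟦ b ⟧
  ⟦+ₚ⟧ a b = ≈-trans (⟦mod⟧ (toℕ a ℕ+ toℕ b)) (≡⇒≈ (ℤ.pos-+ (toℕ a) (toℕ b)))

  ⟦negₚ⟧ : ∀ a → ⟦ negₚ p a ⟧ ≈ - ⟦ a ⟧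
  ⟦negₚ⟧ a = ≈-trans (⟦mod⟧ (p ∸ toℕ a)) (mod-p (divides (+ 1) (begin
    + (p ∸ toℕ a) - - ⟦ a ⟧   ≡⟨ cong (_- - ⟦ a ⟧) p∸a ⟩
    (+ p - ⟦ a ⟧) - - ⟦ a ⟧   ≡⟨ identity (+ p) ⟦ a ⟧ ⟩
    + 1 * + p                 ∎)))
    where open ≡-Reasoning
          p∸a : + (p ∸ toℕ a) ≡ + p - ⟦ a ⟧
          p∸a = trans (sym (ℤ.⊖-≥ (ℕ.<⇒≤ (toℕ<n a)))) (sym (ℤ.m-n≡m⊖n p (toℕ a)))
          identity : ∀ P A → (P - A) - - A ≡ + 1 * P
          identity = solve-∀

  ⟦zeroₚ⟧ : ⟦ zeroₚ p ⟧ ≈ + 0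
  ⟦zeroₚ⟧ = ⟦mod⟧ 0

  oneₚ : Fin p
  oneₚ = 1 mod p

  ⟦oneₚ⟧ : ⟦ oneₚ ⟧ ≈ + 1
  ⟦oneₚ⟧ = ⟦mod⟧ 1

  distance<p : ∀ (a b : Fin p) → ∣ ⟦ a ⟧ - ⟦ b ⟧ ∣ < p
  distance<p a b rewrite ℤ.m-n≡m⊖n (toℕ a) (toℕ b) with ℕ.≤-total (toℕ a) (toℕ b)
  ... | inj₁ a≤b = subst (_< p) (sym (ℤ.∣⊖∣-≤ a≤b))
                     (ℕ.≤-<-trans (ℕ.m∸n≤m (toℕ b) (toℕ a)) (toℕ<n b))
  ... | inj₂ b≤a = subst (_< p) (sym (trans (ℤ.∣m⊖n∣≡∣n⊖m∣ (toℕ a) (toℕ b)) (ℤ.∣⊖∣-≤ b≤a)))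
                     (ℕ.≤-<-trans (ℕ.m∸n≤m (toℕ a) (toℕ b)) (toℕ<n a))

  ≈⇒≡ : ∀ {a b : Fin p} → ⟦ a ⟧ ≈ ⟦ b ⟧ → a ≡ b
  ≈⇒≡ {a} {b} (mod-p d) = toℕ-injective (ℤ.+-injective (ℤ.i-j≡0⇒i≡j _ _ (ℤ.∣i∣≡0⇒i≡0 distance≡0)))
    where
      distance≡0 : ∣ ⟦ a ⟧ - ⟦ b ⟧ ∣ ≡ 0
      distance≡0 with ∣ ⟦ a ⟧ - ⟦ b ⟧ ∣ in eq
      ... | 0     = refl
      ... | suc δ = ⊥-elim (ℕ∣.>⇒∤ (subst (_< p) eq (distance<p a b)) (subst (p ℕ∣.∣_) eq (∣⇒∣ᵤ d)))

  no-zero-divisors : Prime p → ∀ x y → x * y ≈ + 0 → x ≈ + 0 ⊎ y ≈ + 0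
  no-zero-divisors p-prime x y (mod-p d)
    with euclidsLemma ∣ x ∣ ∣ y ∣ p-prime (subst (p ℕ∣.∣_) (ℤ.abs-* x y) (∣⇒∣ᵤ (subst (+ p ∣_) (ℤ.+-identityʳ (x * y)) d)))
  ... | inj₁ p∣x = inj₁ (mod-p (subst (+ p ∣_) (sym (ℤ.+-identityʳ x)) (∣ᵤ⇒∣ p∣x)))
  ... | inj₂ p∣y = inj₂ (mod-p (subst (+ p ∣_) (sym (ℤ.+-identityʳ y)) (∣ᵤ⇒∣ p∣y)))

module VecFacts where

  open import Data.Nat using (_+_)

  lookup-ext : ∀ {A : Set} {n} {xs ys : Vec A n} → (∀ i → lookup xs i ≡ lookup ys i) → xs ≡ ys
  lookup-ext {xs = xs} {ys} h = trans (sym (tabulate∘lookup xs)) (trans (tabulate-cong h) (tabulate∘lookup ys))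

  ++-ext : ∀ {A : Set} {k m} {x : Vec A (k + m)} {y : Vec A k} {z : Vec A m} →
           (∀ i → lookup x (i ↑ˡ m) ≡ lookup y i) → (∀ j → lookup x (k ↑ʳ j) ≡ lookup z j) → x ≡ y ++ z
  ++-ext {k = zero} {y = []} _ h = lookup-ext h
  ++-ext {k = suc k} {x = a ∷ x} {y = b ∷ y} g h =
    cong₂ _∷_ (g zero) (++-ext {x = x} {y = y} (λ i → g (suc i)) h)

  replicate-++ : ∀ {A : Set} k {m} (a : A) → replicate (k + m) a ≡ replicate k a ++ replicate m a
  replicate-++ zero    a = refl
  replicate-++ (suc k) a = cong (a ∷_) (replicate-++ k a)

open VecFacts

-- The vector space 𝔽_p^n with the operations of Defs.  A vector is read through
-- its integer coordinates x ⟨ j ⟩, and vector identities are proved coordinatewise.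
-- A matrix is a vector of rows, and u ·ᴹ A = lincomb u A is the row vector u
-- times A; the single lemma lincomb-coord computes its coordinates as integer
-- dot products, from which linearity and the unit-vector identities follow.
module Vectors (p : ℕ) .{{_ : NonZero p}} where

  open import Data.Nat using () renaming (_*_ to _ℕ*_)
  open import Data.Integer using (ℤ; +_; -_; _+_; _-_; _*_)
  import Data.Integer.Properties as ℤ
  open import Data.Integer.Tactic.RingSolver using (solve-∀)
  open Congruence p public

  𝔽 : Set
  𝔽 = Fin p

  infixl 6 _+ᵥ_ _-ᵥ_
  infix  8 -ᵥ_
  infixl 7 _·ᴹ_

  _+ᵥ_ : ∀ {n} → Point p n → Point p n → Point p n
  _+ᵥ_ = _⊕_ p

  -ᵥ_ : ∀ {n} → Point p n → Point p n
  -ᵥ_ = ⊖_ p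

  _-ᵥ_ : ∀ {n} → Point p n → Point p n → Point p n
  _-ᵥ_ = _⊝_ p

  0ᵥ : ∀ {n} → Point p n
  0ᵥ = 𝟎 p

  _⟨_⟩ : ∀ {n} → Point p n → Fin n → ℤ
  x ⟨ j ⟩ = ⟦ lookup x j ⟧

  coord-ext : ∀ {n} {x y : Point p n} → (∀ j → x ⟨ j ⟩ ≈ y ⟨ j ⟩) → x ≡ y
  coord-ext h = lookup-ext (λ j → ≈⇒≡ (h j))

  +ᵥ-coord : ∀ {n} (x y : Point p n) j → (x +ᵥ y) ⟨ j ⟩ ≈ x ⟨ j ⟩ + y ⟨ j ⟩
  +ᵥ-coord x y j = ≈-trans (≡⇒≈ (cong ⟦_⟧ (lookup-zipWith (_+ₚ_ p) j x y))) (⟦+ₚ⟧ (lookup x j) (lookup y j))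

  -ᵥ-coord : ∀ {n} (x : Point p n) j → (-ᵥ x) ⟨ j ⟩ ≈ - x ⟨ j ⟩
  -ᵥ-coord x j = ≈-trans (≡⇒≈ (cong ⟦_⟧ (lookup-map j (negₚ p) x))) (⟦negₚ⟧ _)

  diff-coord : ∀ {n} (x y : Point p n) j → (x -ᵥ y) ⟨ j ⟩ ≈ x ⟨ j ⟩ - y ⟨ j ⟩
  diff-coord x y j = ≈-trans (+ᵥ-coord x (-ᵥ y) j) (+-cong (≈-refl {x ⟨ j ⟩}) (-ᵥ-coord y j))

  0ᵥ-coord : ∀ {n} j → (0ᵥ {n}) ⟨ j ⟩ ≈ + 0
  0ᵥ-coord j = ≈-trans (≡⇒≈ (cong ⟦_⟧ (lookup-replicate j (zeroₚ p)))) ⟦zeroₚ⟧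

  -ᵥ-exchange : ∀ {n} {a b c d : Point p n} → a -ᵥ b ≡ c -ᵥ d → a -ᵥ c ≡ b -ᵥ d
  -ᵥ-exchange {a = a} {b} {c} {d} h = coord-ext λ j → begin
    (a -ᵥ c) ⟨ j ⟩     ≈⟨ diff-coord a c j ⟩
    a ⟨ j ⟩ - c ⟨ j ⟩  ≈⟨ ≈-via (exchange (a ⟨ j ⟩) (b ⟨ j ⟩) (c ⟨ j ⟩) (d ⟨ j ⟩)) (differences j) ⟩
    b ⟨ j ⟩ - d ⟨ j ⟩  ≈⟨ diff-coord b d j ⟨
    (b -ᵥ d) ⟨ j ⟩     ∎
    where
      open ≈-Reasoning
      differences : ∀ j → a ⟨ j ⟩ - b ⟨ j ⟩ ≈ c ⟨ j ⟩ - d ⟨ j ⟩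
      differences j = begin
        a ⟨ j ⟩ - b ⟨ j ⟩  ≈⟨ diff-coord a b j ⟨
        (a -ᵥ b) ⟨ j ⟩     ≡⟨ cong (_⟨ j ⟩) h ⟩
        (c -ᵥ d) ⟨ j ⟩     ≈⟨ diff-coord c d j ⟩
        c ⟨ j ⟩ - d ⟨ j ⟩  ∎
      exchange : ∀ a b c d → (a - b) - (c - d) ≡ (a - c) - (b - d)
      exchange = solve-∀

  dot : ∀ {k} → Vec 𝔽 k → Vec 𝔽 k → ℤ
  dot []      []      = + 0
  dot (c ∷ u) (a ∷ w) = ⟦ c ⟧ * ⟦ a ⟧ + dot u w

  column : ∀ {k n} → Fin n → Vec (Point p n) k → Vec 𝔽 k
  column j b = map (λ r → lookup r j) b

  _·ᴹ_ : ∀ {k n} → Vec 𝔽 k → Vec (Point p n) k → Point p n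
  u ·ᴹ A = lincomb p u A

  lincomb-coord : ∀ {k n} (c : Vec 𝔽 k) (b : Vec (Point p n) k) j → (c ·ᴹ b) ⟨ j ⟩ ≈ dot c (column j b)
  lincomb-coord {k} c b j =
    ≈-trans (≡⇒≈ (cong ⟦_⟧ (lookup∘tabulate _ j))) (≈-trans (⟦mod⟧ _) (≡⇒≈ (sum≡dot c b)))
    where
      sum≡dot : ∀ {k} (c : Vec 𝔽 k) (b : Vec (Point p _) k) →
                + sumFin k (λ i → toℕ (lookup c i) ℕ* toℕ (lookup (lookup b i) j)) ≡ dot c (column j b)
      sum≡dot []      []      = refl
      sum≡dot (c ∷ u) (r ∷ b) =
        trans (ℤ.pos-+ (toℕ c ℕ* toℕ (lookup r j)) _) (cong₂ _+_ (ℤ.pos-* (toℕ c) (toℕ (lookup r j))) (sum≡dot u b))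

  dot-comm : ∀ {k} (u w : Vec 𝔽 k) → dot u w ≡ dot w u
  dot-comm []      []      = refl
  dot-comm (c ∷ u) (a ∷ w) = cong₂ _+_ (ℤ.*-comm ⟦ c ⟧ ⟦ a ⟧) (dot-comm u w)

  dot-+ : ∀ {k} (u u′ w : Vec 𝔽 k) → dot (u +ᵥ u′) w ≈ dot u w + dot u′ w
  dot-+ []      []        []      = ≈-refl
  dot-+ (c ∷ u) (c′ ∷ u′) (a ∷ w) =
    ≈-trans (+-cong (*-cong (⟦+ₚ⟧ c c′) ≈-refl) (dot-+ u u′ w)) (≡⇒≈ (identity ⟦ c ⟧ ⟦ c′ ⟧ ⟦ a ⟧ (dot u w) (dot u′ w)))
    where identity : ∀ c c′ a x y → (c + c′) * a + (x + y) ≡ (c * a + x) + (c′ * a + y)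
          identity = solve-∀

  dot-neg : ∀ {k} (u w : Vec 𝔽 k) → dot (-ᵥ u) w ≈ - dot u w
  dot-neg []      []      = ≈-refl
  dot-neg (c ∷ u) (a ∷ w) =
    ≈-trans (+-cong (*-cong (⟦negₚ⟧ c) ≈-refl) (dot-neg u w)) (≡⇒≈ (identity ⟦ c ⟧ ⟦ a ⟧ (dot u w)))
    where identity : ∀ c a x → (- c) * a + (- x) ≡ - (c * a + x)
          identity = solve-∀

  dot-0 : ∀ {k} (w : Vec 𝔽 k) → dot 0ᵥ w ≈ + 0
  dot-0 []      = ≈-refl
  dot-0 (a ∷ w) = +-cong (*-cong ⟦zeroₚ⟧ (≈-refl {⟦ a ⟧})) (dot-0 w)

  ·ᴹ-+ : ∀ {k n} (u u′ : Vec 𝔽 k) (A : Vec (Point p n) k) → (u +ᵥ u′) ·ᴹ A ≡ u ·ᴹ A +ᵥ u′ ·ᴹ A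
  ·ᴹ-+ u u′ A = coord-ext λ j → begin
    ((u +ᵥ u′) ·ᴹ A) ⟨ j ⟩                    ≈⟨ lincomb-coord (u +ᵥ u′) A j ⟩
    dot (u +ᵥ u′) (column j A)                ≈⟨ dot-+ u u′ (column j A) ⟩
    dot u (column j A) + dot u′ (column j A)  ≈⟨ +-cong (lincomb-coord u A j) (lincomb-coord u′ A j) ⟨
    (u ·ᴹ A) ⟨ j ⟩ + (u′ ·ᴹ A) ⟨ j ⟩           ≈⟨ +ᵥ-coord (u ·ᴹ A) (u′ ·ᴹ A) j ⟨
    (u ·ᴹ A +ᵥ u′ ·ᴹ A) ⟨ j ⟩                 ∎
    where open ≈-Reasoning

  ·ᴹ-neg : ∀ {k n} (u : Vec 𝔽 k) (A : Vec (Point p n) k) → (-ᵥ u) ·ᴹ A ≡ -ᵥ (u ·ᴹ A)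
  ·ᴹ-neg u A = coord-ext λ j → begin
    ((-ᵥ u) ·ᴹ A) ⟨ j ⟩      ≈⟨ lincomb-coord (-ᵥ u) A j ⟩
    dot (-ᵥ u) (column j A)  ≈⟨ dot-neg u (column j A) ⟩
    - dot u (column j A)     ≈⟨ -‿cong (lincomb-coord u A j) ⟨
    - (u ·ᴹ A) ⟨ j ⟩         ≈⟨ -ᵥ-coord (u ·ᴹ A) j ⟨
    (-ᵥ (u ·ᴹ A)) ⟨ j ⟩      ∎
    where open ≈-Reasoning

  ·ᴹ-diff : ∀ {k n} (u u′ : Vec 𝔽 k) (A : Vec (Point p n) k) → (u -ᵥ u′) ·ᴹ A ≡ u ·ᴹ A -ᵥ u′ ·ᴹ A
  ·ᴹ-diff u u′ A = trans (·ᴹ-+ u (-ᵥ u′) A) (cong (u ·ᴹ A +ᵥ_) (·ᴹ-neg u′ A))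

  ·ᴹ-0 : ∀ {k n} (A : Vec (Point p n) k) → 0ᵥ ·ᴹ A ≡ 0ᵥ
  ·ᴹ-0 A = coord-ext λ j → begin
    (0ᵥ ·ᴹ A) ⟨ j ⟩      ≈⟨ lincomb-coord 0ᵥ A j ⟩
    dot 0ᵥ (column j A)  ≈⟨ dot-0 (column j A) ⟩
    + 0                  ≈⟨ 0ᵥ-coord j ⟨
    0ᵥ ⟨ j ⟩             ∎
    where open ≈-Reasoning

  column-++ˡ : ∀ {k m n} (B : Vec (Point p m) k) (C : Vec (Point p n) k) i →
               column (i ↑ˡ n) (zipWith _++_ B C) ≡ column i B
  column-++ˡ []      []      i = refl
  column-++ˡ (b ∷ B) (c ∷ C) i = cong₂ _∷_ (lookup-++ˡ b c i) (column-++ˡ B C i)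

  column-++ʳ : ∀ {k m n} (B : Vec (Point p m) k) (C : Vec (Point p n) k) j →
               column (m ↑ʳ j) (zipWith _++_ B C) ≡ column j C
  column-++ʳ []      []      j = refl
  column-++ʳ (b ∷ B) (c ∷ C) j = cong₂ _∷_ (lookup-++ʳ b c j) (column-++ʳ B C j)

  ·ᴹ-++ : ∀ {k m n} (u : Vec 𝔽 k) (B : Vec (Point p m) k) (C : Vec (Point p n) k) →
          u ·ᴹ zipWith _++_ B C ≡ u ·ᴹ B ++ u ·ᴹ C
  ·ᴹ-++ u B C = ++-ext {y = u ·ᴹ B} {z = u ·ᴹ C} (λ i → ≈⇒≡ (same-dot (column-++ˡ B C i) (lincomb-coord u B i)))
                       (λ j → ≈⇒≡ (same-dot (column-++ʳ B C j) (lincomb-coord u C j)))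
    where
      same-dot : ∀ {j col x} → column j (zipWith _++_ B C) ≡ col → x ≈ dot u col →
                 (u ·ᴹ zipWith _++_ B C) ⟨ j ⟩ ≈ x
      same-dot {j} eq h = ≈-trans (lincomb-coord u (zipWith _++_ B C) j) (≈-trans (≡⇒≈ (cong (dot u) eq)) (≈-sym h))

  e : ∀ {k} → Fin k → Vec 𝔽 k
  e zero    = oneₚ ∷ 0ᵥ
  e (suc i) = zeroₚ p ∷ e i

  I : ∀ {k} → Vec (Vec 𝔽 k) k
  I = tabulate e

  e-symmetric : ∀ {k} (i j : Fin k) → lookup (e i) j ≡ lookup (e j) i
  e-symmetric zero    zero    = refl
  e-symmetric zero    (suc j) = lookup-replicate j (zeroₚ p)
  e-symmetric (suc i) zero    = sym (lookup-replicate i (zeroₚ p))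
  e-symmetric (suc i) (suc j) = e-symmetric i j

  dot-e : ∀ {k} (i : Fin k) (w : Vec 𝔽 k) → dot (e i) w ≈ w ⟨ i ⟩
  dot-e zero    (a ∷ w) = ≈-trans (+-cong (*-cong ⟦oneₚ⟧ (≈-refl {⟦ a ⟧})) (dot-0 w)) (≡⇒≈ (identity ⟦ a ⟧))
    where identity : ∀ a → + 1 * a + + 0 ≡ a
          identity = solve-∀
  dot-e (suc i) (a ∷ w) = ≈-trans (+-cong (*-cong ⟦zeroₚ⟧ (≈-refl {⟦ a ⟧})) (dot-e i w)) (≡⇒≈ (identity ⟦ a ⟧ (w ⟨ i ⟩)))
    where identity : ∀ a x → + 0 * a + x ≡ x
          identity = solve-∀

  e-·ᴹ : ∀ {k n} (i : Fin k) (A : Vec (Point p n) k) → e i ·ᴹ A ≡ lookup A i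
  e-·ᴹ i A = coord-ext λ j → begin
    (e i ·ᴹ A) ⟨ j ⟩          ≈⟨ lincomb-coord (e i) A j ⟩
    dot (e i) (column j A)    ≈⟨ dot-e i (column j A) ⟩
    (column j A) ⟨ i ⟩        ≡⟨ cong ⟦_⟧ (lookup-map i (λ r → lookup r j) A) ⟩
    (lookup A i) ⟨ j ⟩        ∎
    where open ≈-Reasoning

  -- the identity matrix is symmetric, so its columns are the unit vectors
  ·ᴹ-I : ∀ {k} (c : Vec 𝔽 k) → c ·ᴹ I ≡ c
  ·ᴹ-I c = coord-ext λ j → begin
    (c ·ᴹ I) ⟨ j ⟩      ≈⟨ lincomb-coord c I j ⟩
    dot c (column j I)  ≡⟨ cong (dot c) (column-I j) ⟩
    dot c (e j)         ≡⟨ dot-comm c (e j) ⟩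
    dot (e j) c         ≈⟨ dot-e j c ⟩
    c ⟨ j ⟩             ∎
    where
      open ≈-Reasoning
      column-I : ∀ j → column j I ≡ e j
      column-I j = lookup-ext λ i → trans (lookup-map i (λ r → lookup r j) I)
                                      (trans (cong (λ r → lookup r j) (lookup∘tabulate e i)) (e-symmetric i j))

module Counting where

  open import Data.Nat using (_+_; _*_)

  ∑-mono : ∀ {n} {f g : Fin n → ℕ} → (∀ i → f i ≤ g i) → sum f ≤ sum g
  ∑-mono {zero}  _ = z≤n
  ∑-mono {suc n} h = ℕ.+-mono-≤ (h zero) (∑-mono (λ i → h (suc i)))

  ∑-const : ∀ n c → ∑[ i < n ] c ≡ n * c
  ∑-const zero    c = refl
  ∑-const (suc n) c = cong (c +_) (∑-const n c)

  ∑-++ : ∀ m {n} (g : Fin (m + n) → ℕ) → sum g ≡ ∑[ i < m ] g (i ↑ˡ n) + ∑[ j < n ] g (m ↑ʳ j)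
  ∑-++ zero    g = refl
  ∑-++ (suc m) g = trans (cong (g zero +_) (∑-++ m (λ i → g (suc i)))) (sym (ℕ.+-assoc (g zero) _ _))

  ∑-combine : ∀ a b (g : Fin (a * b) → ℕ) → sum g ≡ ∑[ i < a ] ∑[ j < b ] g (combine i j)
  ∑-combine zero    b g = refl
  ∑-combine (suc a) b g = trans (∑-++ b g) (cong (∑[ j < b ] g (j ↑ˡ (a * b)) +_) (∑-combine a b (λ t → g (b ↑ʳ t))))

  witness : ∀ {P : Set} (d : Dec P) → T (does d) → P
  witness (yes p) _ = p

  decided : ∀ {P : Set} (d : Dec P) → P → T (does d)
  decided (yes _) _ = _
  decided (no ¬p) p = ¬p p

  𝟙 : Bool → ℕ
  𝟙 true  = 1
  𝟙 false = 0

  count : ∀ {n} → (Fin n → Bool) → ℕ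
  count {n} χ = ∑[ i < n ] 𝟙 (χ i)

  count-complement : ∀ {n} (χ : Fin n → Bool) → count χ + count (λ i → not (χ i)) ≡ n
  count-complement {n} χ = begin
    count χ + count (λ i → not (χ i))    ≡⟨ ∑-distrib-+ (λ i → 𝟙 (χ i)) (λ i → 𝟙 (not (χ i))) ⟨
    ∑[ i < n ] (𝟙 (χ i) + 𝟙 (not (χ i))) ≡⟨ sum-cong-≗ (λ i → one (χ i)) ⟩
    ∑[ i < n ] 1                         ≡⟨ trans (∑-const n 1) (ℕ.*-identityʳ n) ⟩
    n                                    ∎
    where open ≡-Reasoning
          one : ∀ b → 𝟙 b + 𝟙 (not b) ≡ 1
          one true  = refl
          one false = refl

  _without_ : ∀ {n} → (Fin n → Bool) → Fin n → Fin n → Bool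
  (χ without j) i = χ i ∧ not (does (i Fin.≟ j))

  count-remove : ∀ {n} (χ : Fin n → Bool) j → T (χ j) → count χ ≡ suc (count (χ without j))
  count-remove χ zero χ₀ with χ zero
  ... | true = cong suc (sum-cong-≗ (λ i → cong 𝟙 (sym (∧-identityʳ (χ (suc i))))))
  count-remove χ (suc j) χⱼ = begin
    𝟙 (χ zero) + count (λ i → χ (suc i))                  ≡⟨ cong (𝟙 (χ zero) +_) (count-remove (λ i → χ (suc i)) j χⱼ) ⟩
    𝟙 (χ zero) + suc (count ((λ i → χ (suc i)) without j)) ≡⟨ ℕ.+-suc (𝟙 (χ zero)) _ ⟩
    suc (𝟙 (χ zero) + count ((λ i → χ (suc i)) without j)) ≡⟨ cong (λ b → suc (𝟙 b + count ((λ i → χ (suc i)) without j))) (sym (∧-identityʳ (χ zero))) ⟩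
    suc (count (χ without suc j))                          ∎
    where open ≡-Reasoning

  count-injection : ∀ {a b} (χ : Fin a → Bool) (χ′ : Fin b → Bool) (φ : Fin a → Fin b) →
                    (∀ {i j} → T (χ i) → T (χ j) → φ i ≡ φ j → i ≡ j) →
                    (∀ {i} → T (χ i) → T (χ′ (φ i))) → count χ ≤ count χ′
  count-injection {zero}  χ χ′ φ inj into = z≤n
  count-injection {suc a} χ χ′ φ inj into with χ zero in χ₀
  ... | false = count-injection (λ i → χ (suc i)) χ′ (λ i → φ (suc i))
                  (λ χi χj eq → suc-injective (inj χi χj eq)) into
  ... | true  = subst (suc (count (λ i → χ (suc i))) ≤_)
                  (sym (count-remove χ′ (φ zero) (into (subst T (sym χ₀) _))))
                  (s≤s (count-injection (λ i → χ (suc i)) (χ′ without φ zero) (λ i → φ (suc i))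
                    (λ χi χj eq → suc-injective (inj χi χj eq)) into-rest))
    where
      into-rest : ∀ {i} → T (χ (suc i)) → T ((χ′ without φ zero) (φ (suc i)))
      into-rest {i} χi with φ (suc i) Fin.≟ φ zero
      ... | yes eq = ⊥-elim (suc≢zero (inj χi (subst T (sym χ₀) _) eq))
        where suc≢zero : ¬ suc i ≡ zero
              suc≢zero ()
      ... | no  _  = subst T (sym (∧-identityʳ _)) (into χi)

  count≤1 : ∀ {n} (χ : Fin n → Bool) → (∀ {i j} → T (χ i) → T (χ j) → i ≡ j) → count χ ≤ 1
  count≤1 χ unique = count-injection {b = 1} χ (λ _ → true) (λ _ → zero) (λ χi χj _ → unique χi χj) _

  markov : ∀ {n} (w : Fin n → ℕ) c → count (λ i → not (w i ≤ᵇ c)) * suc c ≤ sum w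
  markov {zero}  w c = z≤n
  markov {suc n} w c = begin
    (𝟙 (not (w zero ≤ᵇ c)) + count (λ i → not (w (suc i) ≤ᵇ c))) * suc c
      ≡⟨ ℕ.*-distribʳ-+ (suc c) (𝟙 (not (w zero ≤ᵇ c))) _ ⟩
    𝟙 (not (w zero ≤ᵇ c)) * suc c + count (λ i → not (w (suc i) ≤ᵇ c)) * suc c
      ≤⟨ ℕ.+-mono-≤ (heavy (w zero)) (markov (λ i → w (suc i)) c) ⟩
    w zero + ∑[ i < n ] w (suc i) ∎
    where
      open ℕ.≤-Reasoning
      heavy : ∀ v → 𝟙 (not (v ≤ᵇ c)) * suc c ≤ v
      heavy v with v ≤ᵇ c in eq
      ... | true  = z≤n
      ... | false = ℕ.≤-trans (ℕ.≤-reflexive (ℕ.+-identityʳ (suc c)))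
                              (ℕ.≰⇒> (λ v≤c → subst T eq (ℕ.≤⇒≤ᵇ v≤c)))

open Counting

-- Enumerated finite types: a type in bijection with Fin size, so that sums over
-- it are finite sums.
module Enumerations where

  open import Data.Nat using (_+_; _*_)

  record Enumeration (A : Set) : Set where
    field
      size          : ℕ
      decode        : Fin size → A
      encode        : A → Fin size
      decode-encode : ∀ a → decode (encode a) ≡ a
      encode-decode : ∀ i → encode (decode i) ≡ i

    decode-injective : ∀ {i j} → decode i ≡ decode j → i ≡ j
    decode-injective {i} {j} eq = trans (sym (encode-decode i)) (trans (cong encode eq) (encode-decode j))

    encode-injective : ∀ {a b} → encode a ≡ encode b → a ≡ b
    encode-injective {a} {b} eq = trans (sym (decode-encode a)) (trans (cong decode eq) (decode-encode b))

  open Enumeration public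

  ∑ᴱ : ∀ {A} → Enumeration A → (A → ℕ) → ℕ
  ∑ᴱ E h = ∑[ i < size E ] h (decode E i)

  ∑ᴱ-mono : ∀ {A} (E : Enumeration A) {f g : A → ℕ} → (∀ a → f a ≤ g a) → ∑ᴱ E f ≤ ∑ᴱ E g
  ∑ᴱ-mono E h = ∑-mono (λ i → h (decode E i))

  enumBool : Enumeration Bool
  enumBool = record { size = 2 ; decode = dec ; encode = enc ; decode-encode = de ; encode-decode = ed }
    where
      dec : Fin 2 → Bool
      dec zero    = false
      dec (suc _) = true
      enc : Bool → Fin 2
      enc false = zero
      enc true  = suc zero
      de : ∀ b → dec (enc b) ≡ b
      de false = refl
      de true  = refl
      ed : ∀ i → enc (dec i) ≡ i
      ed zero       = refl
      ed (suc zero) = refl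

  enumFin : ∀ n → Enumeration (Fin n)
  enumFin n = record { size = n ; decode = λ i → i ; encode = λ i → i
                     ; decode-encode = λ _ → refl ; encode-decode = λ _ → refl }

  enumVec : ∀ {A} → Enumeration A → ∀ k → Enumeration (Vec A k)
  enumVec E zero = record { size = 1 ; decode = λ _ → [] ; encode = λ _ → zero
                          ; decode-encode = λ { [] → refl } ; encode-decode = λ { zero → refl } }
  enumVec E (suc k) = record { size = size E * size Eₖ ; decode = dec ; encode = enc
                             ; decode-encode = de ; encode-decode = ed }
    where
      Eₖ : Enumeration (Vec _ k)
      Eₖ = enumVec E k
      dec : Fin (size E * size Eₖ) → Vec _ (suc k)
      dec ℓ = decode E (proj₁ (remQuot {size E} (size Eₖ) ℓ)) ∷ decode Eₖ (proj₂ (remQuot {size E} (size Eₖ) ℓ))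
      enc : Vec _ (suc k) → Fin (size E * size Eₖ)
      enc (a ∷ as) = combine (encode E a) (encode Eₖ as)
      de : ∀ v → dec (enc v) ≡ v
      de (a ∷ as) = trans (cong (λ r → decode E (proj₁ r) ∷ decode Eₖ (proj₂ r))
                                (remQuot-combine {size E} {size Eₖ} (encode E a) (encode Eₖ as)))
                          (cong₂ _∷_ (decode-encode E a) (decode-encode Eₖ as))
      ed : ∀ ℓ → enc (dec ℓ) ≡ ℓ
      ed ℓ = trans (cong₂ combine (encode-decode E _) (encode-decode Eₖ _)) (combine-remQuot {size E} (size Eₖ) ℓ)

  size-enumVec : ∀ {A} (E : Enumeration A) k → size (enumVec E k) ≡ size E ^ k
  size-enumVec E zero    = refl
  size-enumVec E (suc k) = cong (size E *_) (size-enumVec E k)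

  ∑ᴱ-cons : ∀ {A} (E : Enumeration A) k (h : Vec A (suc k) → ℕ) →
            ∑ᴱ (enumVec E (suc k)) h ≡ ∑ᴱ E (λ a → ∑ᴱ (enumVec E k) (λ as → h (a ∷ as)))
  ∑ᴱ-cons E k h = trans (∑-combine (size E) (size (enumVec E k)) _)
    (sum-cong-≗ λ i → sum-cong-≗ λ j →
      cong (λ r → h (decode E (proj₁ r) ∷ decode (enumVec E k) (proj₂ r))) (remQuot-combine {size E} {size (enumVec E k)} i j))

  weight : ∀ {L} → Vec Bool L → ℕ
  weight v = count (lookup v)

  low-weight : ℕ → ℕ → ℕ
  low-weight L c = ∑ᴱ (enumVec enumBool L) (λ v → 𝟙 (weight v ≤ᵇ c))

  low-weight-cons : ∀ L c → low-weight (suc L) c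
                    ≡ low-weight L c + ∑ᴱ (enumVec enumBool L) (λ v → 𝟙 (suc (weight v) ≤ᵇ c))
  low-weight-cons L c = trans (∑ᴱ-cons enumBool L (λ v → 𝟙 (weight v ≤ᵇ c))) (cong (low-weight L c +_) (ℕ.+-identityʳ _))

  -- low-weight L c ≤ (L + 1)^c, from N(L+1, c+1) = N(L, c+1) + N(L, c)
  low-weight-count : ∀ L c → low-weight L c ≤ suc L ^ c
  low-weight-count zero    c       = ℕ.m^n>0 1 c
  low-weight-count (suc L) zero    = begin
    low-weight (suc L) 0                     ≡⟨ low-weight-cons L 0 ⟩
    low-weight L 0 + ∑ᴱ Vs (λ _ → 0)         ≡⟨ cong (low-weight L 0 +_) (trans (∑-const (size Vs) 0) (ℕ.*-zeroʳ (size Vs))) ⟩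
    low-weight L 0 + 0                       ≡⟨ ℕ.+-identityʳ (low-weight L 0) ⟩
    low-weight L 0                           ≤⟨ low-weight-count L 0 ⟩
    1                                        ∎
    where
      open ℕ.≤-Reasoning
      Vs : Enumeration (Vec Bool L)
      Vs = enumVec enumBool L
  low-weight-count (suc L) (suc c) = begin
    low-weight (suc L) (suc c)               ≡⟨ low-weight-cons L (suc c) ⟩
    low-weight L (suc c) + ∑ᴱ Vs (λ v → 𝟙 (suc (weight v) ≤ᵇ suc c))
                                             ≡⟨ cong (low-weight L (suc c) +_) (sum-cong-≗ (λ i → cong 𝟙 (suc-≤ᵇ (weight (decode Vs i))))) ⟩
    low-weight L (suc c) + low-weight L c    ≤⟨ ℕ.+-mono-≤ (low-weight-count L (suc c)) (low-weight-count L c) ⟩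
    suc L ^ suc c + suc L ^ c                ≡⟨ ℕ.+-comm (suc L ^ suc c) (suc L ^ c) ⟩
    suc (suc L) * suc L ^ c                  ≤⟨ ℕ.*-monoʳ-≤ (suc (suc L)) (ℕ.^-monoˡ-≤ c (ℕ.n≤1+n (suc L))) ⟩
    suc (suc L) ^ suc c                      ∎
    where
      open ℕ.≤-Reasoning
      Vs : Enumeration (Vec Bool L)
      Vs = enumVec enumBool L
      suc-≤ᵇ : ∀ w → (suc w ≤ᵇ suc c) ≡ (w ≤ᵇ c)
      suc-≤ᵇ zero    = refl
      suc-≤ᵇ (suc w) = refl

open Enumerations

-- If two labellings a, b of q points by elements of T induce the
-- same equality pattern (a i = a j ⇔ b i = b j), then b = σ ∘ a for an injective
-- σ : T → T.  σ is built one point at a time, composing with transpositions.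
module Relabelling {T : Set} (_≟_ : DecidableEquality T) where

  transpose : T → T → T → T
  transpose x y z with z ≟ x | z ≟ y
  ... | yes _ | _     = y
  ... | no _  | yes _ = x
  ... | no _  | no _  = z

  transpose-x : ∀ x y → transpose x y x ≡ y
  transpose-x x y with x ≟ x
  ... | yes _  = refl
  ... | no x≢x = ⊥-elim (x≢x refl)

  transpose-y : ∀ x y → transpose x y y ≡ x
  transpose-y x y with y ≟ x | y ≟ y
  ... | yes y≡x | _      = y≡x
  ... | no _    | yes _  = refl
  ... | no _    | no y≢y = ⊥-elim (y≢y refl)

  transpose-other : ∀ {x y z} → ¬ z ≡ x → ¬ z ≡ y → transpose x y z ≡ z
  transpose-other {x} {y} {z} z≢x z≢y with z ≟ x | z ≟ y
  ... | yes z≡x | _       = ⊥-elim (z≢x z≡x)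
  ... | no _    | yes z≡y = ⊥-elim (z≢y z≡y)
  ... | no _    | no _    = refl

  transpose-involutive : ∀ x y z → transpose x y (transpose x y z) ≡ z
  transpose-involutive x y z with z ≟ x | z ≟ y
  ... | yes z≡x | _       = trans (transpose-y x y) (sym z≡x)
  ... | no _    | yes z≡y = trans (transpose-x x y) (sym z≡y)
  ... | no z≢x  | no z≢y  = transpose-other z≢x z≢y

  transpose-injective : ∀ x y {z w} → transpose x y z ≡ transpose x y w → z ≡ w
  transpose-injective x y {z} {w} eq =
    trans (sym (transpose-involutive x y z)) (trans (cong (transpose x y) eq) (transpose-involutive x y w))

  SamePattern : ∀ {q} → (Fin q → T) → (Fin q → T) → Set
  SamePattern a b = ∀ i j → (a i ≡ a j → b i ≡ b j) × (b i ≡ b j → a i ≡ a j)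

  relabel : ∀ q (a b : Fin q → T) → SamePattern a b →
            ∃ λ (σ : T → T) → (∀ {s t} → σ s ≡ σ t → s ≡ t) × (∀ i → σ (a i) ≡ b i)
  relabel zero    a b same = (λ t → t) , (λ eq → eq) , λ ()
  relabel (suc q) a b same with relabel q (λ i → a (suc i)) (λ i → b (suc i)) (λ i j → same (suc i) (suc j))
  ... | σ′ , σ′-injective , σ′-maps = σ , σ-injective , σ-maps
    where
      -- after σ′, send the image of a 0 to b 0
      σ : T → T
      σ t = transpose (σ′ (a zero)) (b zero) (σ′ t)

      σ-injective : ∀ {s t} → σ s ≡ σ t → s ≡ t
      σ-injective eq = σ′-injective (transpose-injective _ _ eq)

      σ-maps : ∀ i → σ (a i) ≡ b i
      σ-maps zero    = transpose-x (σ′ (a zero)) (b zero)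
      σ-maps (suc i) with b (suc i) ≟ σ′ (a zero)
      ... | yes hit = trans (cong (transpose _ _) (trans (σ′-maps i) hit))
                        (trans (transpose-x _ _) (sym (proj₁ (same (suc i) zero) (σ′-injective (trans (σ′-maps i) hit)))))
      ... | no miss = trans (cong (transpose _ _) (σ′-maps i)) (transpose-other miss b≢b₀)
        where
          b≢b₀ : ¬ b (suc i) ≡ b zero
          b≢b₀ eq = miss (trans (sym (σ′-maps i)) (cong σ′ (proj₂ (same (suc i) zero) eq)))

-- The hard instances.  A k × m matrix A defines the graph subgroup
-- S_A = {x : W x = U x ·ᴹ A}, of rank k with basis the rows of [I | A], and the
-- function hide A x = W x - U x ·ᴹ A, constant exactly on the cosets of S_A.
module HardInstances (p : ℕ) .{{_ : NonZero p}} (k m : ℕ) where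

  open import Data.Nat using (_+_)

  open Vectors p public

  Matrix : Set
  Matrix = Vec (Point p m) k

  U : Point p (k + m) → Point p k
  U x = take k x

  W : Point p (k + m) → Point p m
  W x = drop k x

  graph : Matrix → Point p (k + m) → Set
  graph A x = W x ≡ U x ·ᴹ A

  hide : Matrix → Point p (k + m) → Point p m
  hide A x = W x -ᵥ U x ·ᴹ A

  split-++ : ∀ (u : Point p k) (w : Point p m) → U (u ++ w) ≡ u × W (u ++ w) ≡ w
  split-++ u w = ++-injective (U (u ++ w)) u (take++drop≡id k (u ++ w))

  U-+ : ∀ x y → U (x +ᵥ y) ≡ U x +ᵥ U y
  U-+ x y = take-zipWith (_+ₚ_ p) x y

  W-+ : ∀ x y → W (x +ᵥ y) ≡ W x +ᵥ W y
  W-+ x y = drop-zipWith (_+ₚ_ p) x y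

  U-neg : ∀ x → U (-ᵥ x) ≡ -ᵥ U x
  U-neg x = take-map (negₚ p) k x

  W-neg : ∀ x → W (-ᵥ x) ≡ -ᵥ W x
  W-neg x = drop-map (negₚ p) k x

  U-diff : ∀ x y → U (x -ᵥ y) ≡ U x -ᵥ U y
  U-diff x y = trans (U-+ x (-ᵥ y)) (cong (U x +ᵥ_) (U-neg y))

  W-diff : ∀ x y → W (x -ᵥ y) ≡ W x -ᵥ W y
  W-diff x y = trans (W-+ x (-ᵥ y)) (cong (W x +ᵥ_) (W-neg y))

  graph-subgroup : ∀ A → IsSubgroup p (graph A)
  graph-subgroup A = zero∈ , +∈ , neg∈
    where
      0-split : U 0ᵥ ≡ 0ᵥ × W 0ᵥ ≡ 0ᵥ
      0-split = subst (λ z → U z ≡ 0ᵥ × W z ≡ 0ᵥ) (sym (replicate-++ k (zeroₚ p))) (split-++ 0ᵥ 0ᵥ)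
      zero∈ : graph A 0ᵥ
      zero∈ = trans (proj₂ 0-split) (sym (trans (cong (_·ᴹ A) (proj₁ 0-split)) (·ᴹ-0 A)))
      +∈ : ∀ x y → graph A x → graph A y → graph A (x +ᵥ y)
      +∈ x y gx gy = trans (W-+ x y) (trans (cong₂ _+ᵥ_ gx gy)
                       (sym (trans (cong (_·ᴹ A) (U-+ x y)) (·ᴹ-+ (U x) (U y) A))))
      neg∈ : ∀ x → graph A x → graph A (-ᵥ x)
      neg∈ x gx = trans (W-neg x) (trans (cong -ᵥ_ gx) (sym (trans (cong (_·ᴹ A) (U-neg x)) (·ᴹ-neg (U x) A))))

  U-diff·ᴹ : ∀ (A : Matrix) x y → U (x -ᵥ y) ·ᴹ A ≡ U x ·ᴹ A -ᵥ U y ·ᴹ A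
  U-diff·ᴹ A x y = trans (cong (_·ᴹ A) (U-diff x y)) (·ᴹ-diff (U x) (U y) A)

  hide≡⇒graph : ∀ (A : Matrix) x y → hide A x ≡ hide A y → graph A (x -ᵥ y)
  hide≡⇒graph A x y eq = trans (W-diff x y) (trans (-ᵥ-exchange eq) (sym (U-diff·ᴹ A x y)))

  graph⇒hide≡ : ∀ (A : Matrix) x y → graph A (x -ᵥ y) → hide A x ≡ hide A y
  graph⇒hide≡ A x y g = -ᵥ-exchange (trans (sym (W-diff x y)) (trans g (U-diff·ᴹ A x y)))

  basis : Matrix → Vec (Point p (k + m)) k
  basis A = zipWith _++_ I A

  basis-combination : ∀ A (c : Vec 𝔽 k) → c ·ᴹ basis A ≡ c ++ c ·ᴹ A
  basis-combination A c = trans (·ᴹ-++ c I A) (cong (_++ c ·ᴹ A) (·ᴹ-I c))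

  graph-member : ∀ A (c : Vec 𝔽 k) → graph A (c ++ c ·ᴹ A)
  graph-member A c = trans (proj₂ (split-++ c (c ·ᴹ A))) (cong (_·ᴹ A) (sym (proj₁ (split-++ c (c ·ᴹ A)))))

  graph-rank : ∀ A → HasRank p k (graph A)
  graph-rank A = basis A , independent , λ x → spanned x , member x
    where
      independent : ∀ c c′ → c ·ᴹ basis A ≡ c′ ·ᴹ basis A → c ≡ c′
      independent c c′ eq = ++-injectiveˡ c c′ (trans (sym (basis-combination A c)) (trans eq (basis-combination A c′)))
      spanned : ∀ x → graph A x → ∃ λ c → c ·ᴹ basis A ≡ x
      spanned x gx = U x , trans (basis-combination A (U x)) (trans (cong (U x ++_) (sym gx)) (take++drop≡id k x))
      member : ∀ x → (∃ λ c → c ·ᴹ basis A ≡ x) → graph A x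
      member x (c , eq) = subst (graph A) (trans (sym (basis-combination A c)) eq) (graph-member A c)

  -- S_A determines A: the point e i ++ e i ·ᴹ A of S_A pins down the i-th row
  graph-determines : ∀ A A′ → (∀ x → graph A x → graph A′ x) → A ≡ A′
  graph-determines A A′ S⊆S′ = lookup-ext row
    where
      open ≡-Reasoning
      row : ∀ i → lookup A i ≡ lookup A′ i
      row i = begin
        lookup A i   ≡⟨ sym (e-·ᴹ i A) ⟩
        e i ·ᴹ A     ≡⟨ sym (proj₂ split) ⟩
        W x          ≡⟨ S⊆S′ x (graph-member A (e i)) ⟩
        U x ·ᴹ A′    ≡⟨ cong (_·ᴹ A′) (proj₁ split) ⟩
        e i ·ᴹ A′    ≡⟨ e-·ᴹ i A′ ⟩
        lookup A′ i  ∎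
        where
          x : Point p (k + m)
          x = e i ++ e i ·ᴹ A
          split : U x ≡ e i × W x ≡ e i ·ᴹ A
          split = split-++ (e i) (e i ·ᴹ A)

-- By induction on k: if the leading coefficient
-- of d vanishes, the first row of A is free and the rest solves a smaller
-- equation; otherwise, by the absence of zero divisors, the other rows determine
-- the first one.
module SolutionCount (p : ℕ) .{{_ : NonZero p}} (p-prime : Prime p) (m : ℕ) where

  open import Data.Integer using (ℤ; +_; _+_; _-_; _*_)
  open import Data.Integer.Tactic.RingSolver using (solve-∀)
  open Vectors p

  infix 4 _≟ᵥ_
  _≟ᵥ_ : ∀ {n} → DecidableEquality (Point p n)
  _≟ᵥ_ = ≡-dec Fin._≟_

  enumPoint : Enumeration (Point p m)
  enumPoint = enumVec (enumFin p) m

  P : ℕ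
  P = size enumPoint

  enumMatrix : ∀ k → Enumeration (Vec (Point p m) k)
  enumMatrix k = enumVec enumPoint k

  solutions : ∀ {k} → Vec 𝔽 k → Point p m → ℕ
  solutions {k} d t = ∑ᴱ (enumMatrix k) (λ A → 𝟙 (does (d ·ᴹ A ≟ᵥ t)))

  zero-head : ∀ {k} (w : Vec 𝔽 k) (a : Point p m) (A : Vec (Point p m) k) → (zeroₚ p ∷ w) ·ᴹ (a ∷ A) ≡ w ·ᴹ A
  zero-head w a A = coord-ext λ j → begin
    ((zeroₚ p ∷ w) ·ᴹ (a ∷ A)) ⟨ j ⟩          ≈⟨ lincomb-coord (zeroₚ p ∷ w) (a ∷ A) j ⟩
    ⟦ zeroₚ p ⟧ * a ⟨ j ⟩ + dot w (column j A) ≈⟨ +-cong (*-cong ⟦zeroₚ⟧ (≈-refl {a ⟨ j ⟩})) ≈-refl ⟩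
    + 0 * a ⟨ j ⟩ + dot w (column j A)         ≡⟨ identity (a ⟨ j ⟩) (dot w (column j A)) ⟩
    dot w (column j A)                         ≈⟨ lincomb-coord w A j ⟨
    (w ·ᴹ A) ⟨ j ⟩                             ∎
    where
      open ≈-Reasoning
      identity : ∀ x y → + 0 * x + y ≡ y
      identity = solve-∀

  head-unique : ∀ {k} {c : 𝔽} (w : Vec 𝔽 k) {a b : Point p m} (A : Vec (Point p m) k) → ¬ c ≡ zeroₚ p →
                (c ∷ w) ·ᴹ (a ∷ A) ≡ (c ∷ w) ·ᴹ (b ∷ A) → a ≡ b
  head-unique {c = c} w {a} {b} A c≢0 eq = coord-ext λ j →
    cancel (no-zero-divisors p-prime ⟦ c ⟧ (a ⟨ j ⟩ - b ⟨ j ⟩) (scaled-difference j))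
    where
      open ≈-Reasoning
      identity : ∀ c a b X → (c * a + X) - (c * b + X) ≡ c * (a - b) - + 0
      identity = solve-∀
      -- the j-th coordinates of the two sides differ by ⟦ c ⟧ (a_j - b_j)
      scaled-difference : ∀ j → ⟦ c ⟧ * (a ⟨ j ⟩ - b ⟨ j ⟩) ≈ + 0
      scaled-difference j = ≈-via (identity ⟦ c ⟧ (a ⟨ j ⟩) (b ⟨ j ⟩) (dot w (column j A))) (begin
        ⟦ c ⟧ * a ⟨ j ⟩ + dot w (column j A)  ≈⟨ lincomb-coord (c ∷ w) (a ∷ A) j ⟨
        ((c ∷ w) ·ᴹ (a ∷ A)) ⟨ j ⟩            ≡⟨ cong (_⟨ j ⟩) eq ⟩
        ((c ∷ w) ·ᴹ (b ∷ A)) ⟨ j ⟩            ≈⟨ lincomb-coord (c ∷ w) (b ∷ A) j ⟩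
        ⟦ c ⟧ * b ⟨ j ⟩ + dot w (column j A)  ∎)
      cancel : ∀ {x y} → ⟦ c ⟧ ≈ + 0 ⊎ x - y ≈ + 0 → x ≈ y
      cancel (inj₁ c≈0) = ⊥-elim (c≢0 (≈⇒≡ (≈-trans c≈0 (≈-sym ⟦zeroₚ⟧))))
      cancel {x} {y} (inj₂ x-y≈0) = ≈-via (minus-zero x y) x-y≈0
        where minus-zero : ∀ x y → (x - y) - + 0 ≡ x - y
              minus-zero = solve-∀

  solution-count : ∀ k (d : Vec 𝔽 (suc k)) t → ¬ d ≡ 0ᵥ → solutions d t ≤ P ^ k
  solution-count k (c ∷ w) t d≢0 rewrite ∑ᴱ-cons enumPoint k (λ A → 𝟙 (does ((c ∷ w) ·ᴹ A ≟ᵥ t)))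
    with c Fin.≟ zeroₚ p
  solution-count zero    (c ∷ []) t d≢0 | yes refl = ⊥-elim (d≢0 refl)
  solution-count (suc k) (c ∷ w)  t d≢0 | yes refl = begin
    ∑ᴱ enumPoint (λ a → ∑ᴱ (enumMatrix (suc k)) (λ A → 𝟙 (does ((zeroₚ p ∷ w) ·ᴹ (a ∷ A) ≟ᵥ t))))
      ≡⟨ sum-cong-≗ (λ i → sum-cong-≗ (λ j → cong (λ x → 𝟙 (does (x ≟ᵥ t))) (zero-head w (decode enumPoint i) (decode (enumMatrix (suc k)) j)))) ⟩
    ∑ᴱ enumPoint (λ _ → solutions w t)
      ≤⟨ ∑ᴱ-mono enumPoint (λ _ → solution-count k w t (λ w≡0 → d≢0 (cong (zeroₚ p ∷_) w≡0))) ⟩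
    ∑ᴱ enumPoint (λ _ → P ^ k)
      ≡⟨ ∑-const P (P ^ k) ⟩
    P ^ suc k ∎
    where open ℕ.≤-Reasoning
  solution-count k (c ∷ w) t d≢0 | no c≢0 = begin
    ∑ᴱ enumPoint (λ a → ∑ᴱ (enumMatrix k) (λ A → 𝟙 (does ((c ∷ w) ·ᴹ (a ∷ A) ≟ᵥ t))))
      ≡⟨ ∑-comm (λ i j → 𝟙 (does ((c ∷ w) ·ᴹ (decode enumPoint i ∷ decode (enumMatrix k) j) ≟ᵥ t))) ⟩
    ∑ᴱ (enumMatrix k) (λ A → ∑ᴱ enumPoint (λ a → 𝟙 (does ((c ∷ w) ·ᴹ (a ∷ A) ≟ᵥ t))))
      ≤⟨ ∑ᴱ-mono (enumMatrix k) (λ A → count≤1 (λ i → does ((c ∷ w) ·ᴹ (decode enumPoint i ∷ A) ≟ᵥ t))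
             (λ {i} {j} χi χj → decode-injective enumPoint (head-unique w A c≢0
               (trans (witness (_ ≟ᵥ t) χi) (sym (witness (_ ≟ᵥ t) χj)))))) ⟩
    ∑ᴱ (enumMatrix k) (λ _ → 1)
      ≡⟨ trans (∑-const (size (enumMatrix k)) 1) (trans (ℕ.*-identityʳ _) (size-enumVec enumPoint k)) ⟩
    P ^ k ∎
    where open ℕ.≤-Reasoning

open import Data.Nat using (_+_; _*_)

-- The lower-bound argument, for a fixed nonadaptive algorithm `alg` with q queries
-- y_1 … y_q solving GSP(p, k + m, k) with N ≥ P = p^m possible answers.
--   * Indistinguishability: if hide A and hide A′ induce the same partition of
--     the queries, relabelling the answers makes the two instances look the same
--     to alg, so S_A = S_A′ and A = A′.  Hence A ↦ (hide A y_i)_i is injective and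
--     P^k ≤ P^q.
--   * Collision patterns: A is already determined by the q² bits "y_i - y_j ∈ S_A"
--     over the pairs with U y_i ≠ U y_j, each of which holds for at most P^(k-1)
--     matrices.  By Markov's inequality few matrices have more than c such
--     collisions, while at most (q² + 1)^c patterns have at most c of them.
module LowerBound (p : ℕ) .{{_ : NonZero p}} (p-prime : Prime p) (k′ m N : ℕ)
                  (alg : NonadaptiveAlg p (suc k′ + m) N) (alg-solves : Solves p (suc k′) alg)
                  (P≤N : size (enumVec (enumFin p) m) ≤ N) where

  k : ℕ
  k = suc k′

  open HardInstances p k m
  open SolutionCount p p-prime m public
  open Relabelling (_≟ᵥ_ {m}) using (SamePattern; relabel)

  embed : Point p m → Fin N
  embed v = inject≤ (encode enumPoint v) P≤N

  embed-injective : ∀ {v w} → embed v ≡ embed w → v ≡ w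
  embed-injective eq = encode-injective enumPoint (inject≤-injective P≤N P≤N _ _ eq)

  y : Fin (q alg) → Point p (k + m)
  y i = lookup (queries alg) i

  output-graph : ∀ A (f : Point p (k + m) → Fin N) → Hides p f (graph A) → ∀ x →
                 (output alg (map f (queries alg)) x ≡ true → graph A x) × (graph A x → output alg (map f (queries alg)) x ≡ true)
  output-graph A f hides = alg-solves (graph A) (graph-subgroup A) (graph-rank A) f hides

  indistinguishable : ∀ A A′ → SamePattern (λ i → hide A (y i)) (λ i → hide A′ (y i)) → A ≡ A′
  indistinguishable A A′ same
    -- relabel the values of hide A′ to agree with hide A on the queries
    with relabel (q alg) (λ i → hide A′ (y i)) (λ i → hide A (y i)) (λ i j → swap (same i j))
  ... | σ , σ-injective , σ-maps = graph-determines A A′ S⊆S′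
    where
      f f′ : Point p (k + m) → Fin N
      f  x = embed (hide A x)
      f′ x = embed (σ (hide A′ x))
      f-hides : Hides p f (graph A)
      f-hides x z = (λ eq → hide≡⇒graph A x z (embed-injective eq)) , (λ g → cong embed (graph⇒hide≡ A x z g))
      f′-hides : Hides p f′ (graph A′)
      f′-hides x z = (λ eq → hide≡⇒graph A′ x z (σ-injective (embed-injective eq)))
                   , (λ g → cong (λ v → embed (σ v)) (graph⇒hide≡ A′ x z g))
      same-answers : map f (queries alg) ≡ map f′ (queries alg)
      same-answers = lookup-ext λ i → trans (lookup-map i f (queries alg))
        (trans (cong embed (sym (σ-maps i))) (sym (lookup-map i f′ (queries alg))))
      S⊆S′ : ∀ x → graph A x → graph A′ x
      S⊆S′ x gx = proj₁ (output-graph A′ f′ f′-hides x)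
        (subst (λ answers → output alg answers x ≡ true) same-answers (proj₂ (output-graph A f f-hides x) gx))

  values : Matrix → Vec (Point p m) (q alg)
  values A = map (hide A) (queries alg)

  values-injective : ∀ A A′ → values A ≡ values A′ → A ≡ A′
  values-injective A A′ eq = indistinguishable A A′ λ i j →
    (λ h → trans (sym (at i)) (trans h (at j))) , (λ h → trans (at i) (trans h (sym (at j))))
    where
      at : ∀ i → hide A (y i) ≡ hide A′ (y i)
      at i = begin
        hide A (y i)         ≡⟨ lookup-map i (hide A) (queries alg) ⟨
        lookup (values A) i  ≡⟨ cong (λ v → lookup v i) eq ⟩
        lookup (values A′) i ≡⟨ lookup-map i (hide A′) (queries alg) ⟩
        hide A′ (y i)        ∎
        where open ≡-Reasoning

  -- hence P^k ≤ P^q, so k ≤ q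
  rank≤queries : 1 < P → k ≤ q alg
  rank≤queries 1<P with k ℕ.≤? q alg
  ... | yes k≤q = k≤q
  ... | no  k≰q = ⊥-elim (ℕ.<⇒≱ (ℕ.^-monoʳ-< P 1<P (ℕ.≰⇒> k≰q))
                    (subst₂ _≤_ (size-enumVec enumPoint k) (size-enumVec enumPoint (q alg)) injection))
    where
      injection : size (enumMatrix k) ≤ size (enumVec enumPoint (q alg))
      injection = injective⇒≤ {f = λ i → encode (enumVec enumPoint (q alg)) (values (decode (enumMatrix k) i))}
        λ eq → decode-injective (enumMatrix k) (values-injective _ _ (encode-injective (enumVec enumPoint (q alg)) eq))

  δ : Fin (q alg) → Fin (q alg) → Point p (k + m)
  δ i j = y i -ᵥ y j

  unless : ∀ {Q : Set} → Dec Q → Bool → Bool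
  unless (yes _) _ = false
  unless (no _)  b = b

  collision : Matrix → Fin (q alg) → Fin (q alg) → Bool
  collision A i j = unless (U (δ i j) ≟ᵥ 0ᵥ) (does (U (δ i j) ·ᴹ A ≟ᵥ W (δ i j)))

  L : ℕ
  L = q alg * q alg

  -- position ℓ of a profile holds the pair (i, j) with combine i j = ℓ
  pair : Fin L → Fin (q alg) × Fin (q alg)
  pair ℓ = remQuot (q alg) ℓ

  collision-at : Matrix → Fin L → Bool
  collision-at A ℓ = collision A (proj₁ (pair ℓ)) (proj₂ (pair ℓ))

  profile : Matrix → Vec Bool L
  profile A = tabulate (collision-at A)

  profile-collision : ∀ A i j → lookup (profile A) (combine i j) ≡ collision A i j
  profile-collision A i j = trans (lookup∘tabulate (collision-at A) (combine i j))
    (cong (λ r → collision A (proj₁ r) (proj₂ r)) (remQuot-combine {q alg} {q alg} i j))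

  -- equal collision bits give equal hide-collisions: when U δ = 0, δ ∈ S_A holds
  -- for all A or for none
  collision-transfer : ∀ A A′ i j → collision A i j ≡ collision A′ i j →
                       hide A (y i) ≡ hide A (y j) → hide A′ (y i) ≡ hide A′ (y j)
  collision-transfer A A′ i j same h = graph⇒hide≡ A′ (y i) (y j) (transfer (U (δ i j) ≟ᵥ 0ᵥ) same)
    where
      gA : graph A (δ i j)
      gA = hide≡⇒graph A (y i) (y j) h
      transfer : (u? : Dec (U (δ i j) ≡ 0ᵥ)) → unless u? (does (U (δ i j) ·ᴹ A ≟ᵥ W (δ i j)))
                   ≡ unless u? (does (U (δ i j) ·ᴹ A′ ≟ᵥ W (δ i j))) → graph A′ (δ i j)
      transfer (yes u≡0) _ = begin
        W (δ i j)       ≡⟨ gA ⟩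
        U (δ i j) ·ᴹ A  ≡⟨ cong (_·ᴹ A) u≡0 ⟩
        0ᵥ ·ᴹ A         ≡⟨ ·ᴹ-0 A ⟩
        0ᵥ              ≡⟨ ·ᴹ-0 A′ ⟨
        0ᵥ ·ᴹ A′        ≡⟨ cong (_·ᴹ A′) u≡0 ⟨
        U (δ i j) ·ᴹ A′ ∎
        where open ≡-Reasoning
      transfer (no _) bits = sym (witness (_ ≟ᵥ _) (subst T bits (decided (_ ≟ᵥ _) (sym gA))))

  profile-injective : ∀ A A′ → profile A ≡ profile A′ → A ≡ A′
  profile-injective A A′ eq = indistinguishable A A′ λ i j →
    collision-transfer A A′ i j (bits i j) , collision-transfer A′ A i j (sym (bits i j))
    where
      bits : ∀ i j → collision A i j ≡ collision A′ i j
      bits i j = trans (sym (profile-collision A i j)) (trans (cong (λ v → lookup v (combine i j)) eq) (profile-collision A′ i j))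

  pair-collisions : ∀ i j → ∑ᴱ (enumMatrix k) (λ A → 𝟙 (collision A i j)) ≤ P ^ k′
  pair-collisions i j with U (δ i j) ≟ᵥ 0ᵥ
  ... | yes _ = ℕ.≤-trans (ℕ.≤-reflexive (trans (∑-const (size (enumMatrix k)) 0) (ℕ.*-zeroʳ (size (enumMatrix k))))) z≤n
  ... | no u≢0 = solution-count k′ (U (δ i j)) (W (δ i j)) u≢0

  total-collisions : ∑ᴱ (enumMatrix k) (λ A → weight (profile A)) ≤ L * P ^ k′
  total-collisions = begin
    ∑ᴱ (enumMatrix k) (λ A → weight (profile A))
      ≡⟨ ∑-comm (λ a ℓ → 𝟙 (lookup (profile (decode (enumMatrix k) a)) ℓ)) ⟩
    ∑ᴱ (enumFin L) (λ ℓ → ∑ᴱ (enumMatrix k) (λ A → 𝟙 (lookup (profile A) ℓ)))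
      ≡⟨ sum-cong-≗ (λ ℓ → sum-cong-≗ (λ a → cong 𝟙 (lookup∘tabulate (collision-at (decode (enumMatrix k) a)) ℓ))) ⟩
    ∑ᴱ (enumFin L) (λ ℓ → ∑ᴱ (enumMatrix k) (λ A → 𝟙 (collision-at A ℓ)))
      ≤⟨ ∑ᴱ-mono (enumFin L) (λ ℓ → pair-collisions (proj₁ (pair ℓ)) (proj₂ (pair ℓ))) ⟩
    ∑ᴱ (enumFin L) (λ _ → P ^ k′)
      ≡⟨ ∑-const L (P ^ k′) ⟩
    L * P ^ k′ ∎
    where open ℕ.≤-Reasoning

  light : ℕ → Fin (size (enumMatrix k)) → Bool
  light c a = weight (profile (decode (enumMatrix k) a)) ≤ᵇ c

  heavy-count : ∀ c → count (λ a → not (light c a)) * suc c ≤ L * P ^ k′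
  heavy-count c = ℕ.≤-trans (markov (λ a → weight (profile (decode (enumMatrix k) a))) c) total-collisions

  -- distinct light matrices have distinct profiles of weight at most c
  light-count : ∀ c → count (light c) ≤ suc L ^ c
  light-count c = ℕ.≤-trans
    (count-injection (light c) low (λ a → encode profiles (profile (decode (enumMatrix k) a)))
      (λ _ _ eq → decode-injective (enumMatrix k) (profile-injective _ _ (encode-injective profiles eq)))
      (λ {a} light-a → subst (λ v → T (weight v ≤ᵇ c)) (sym (decode-encode profiles (profile (decode (enumMatrix k) a)))) light-a))
    (low-weight-count L c)
    where
      profiles : Enumeration (Vec Bool L)
      profiles = enumVec enumBool L
      low : Fin (size profiles) → Bool
      low ℓ = weight (decode profiles ℓ) ≤ᵇ c

  collision-counts : ∀ c → ∃₂ λ G B → G + B ≡ P ^ k × B * suc c ≤ L * P ^ k′ × G ≤ suc L ^ c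
  collision-counts c = count (light c) , count (λ a → not (light c a))
                     , trans (count-complement (light c)) (size-enumVec enumPoint k)
                     , heavy-count c , light-count c

-- Suppose
-- 4 q² < k P and take c = ⌊(k-1)/2⌋, so 2c + 1 ≤ k ≤ 2c + 2.  Then the B heavy
-- matrices number at most q² P^(k-1)/(c+1) ≤ P^k / 2, so the G light ones number
-- at least P^k / 2; but G ≤ (q² + 1)^c ≤ P^(2c) < P^(2c+1) / 2 ≤ P^k / 2 as
-- 4q < P.
module Arithmetic where

  open import Data.Nat using (>-nonZero; _≤?_)
  open import Data.Nat.Properties
  open import Data.Nat.Tactic.RingSolver using (solve-∀)

  halves : ∀ n → ∃ λ c → c + c ≤ n × n ≤ suc (c + c)
  halves zero          = 0 , z≤n , z≤n
  halves (suc zero)    = 0 , z≤n , s≤s z≤n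
  halves (suc (suc n)) with halves n
  ... | c , lo , hi = suc c , subst (_≤ suc (suc n)) (sym double) (s≤s (s≤s lo))
                            , subst (suc (suc n) ≤_) (cong suc (sym double)) (s≤s (s≤s hi))
    where double : suc c + suc c ≡ suc (suc (c + c))
          double = cong suc (+-suc c c)

  large-base : ∀ {k q P} → k ≤ q → 4 * (q * q) < k * P → 4 * q < P
  large-base {k} {q} {P} k≤q big = *-cancelˡ-< q (4 * q) P (begin-strict
    q * (4 * q)  ≡⟨ identity q ⟩
    4 * (q * q)  <⟨ big ⟩
    k * P        ≤⟨ *-monoˡ-≤ P k≤q ⟩
    q * P        ∎)
    where open ≤-Reasoning
          identity : ∀ q → q * (4 * q) ≡ 4 * (q * q)
          identity = solve-∀

  few-heavy : ∀ {k′ q P c B} → suc k′ ≤ suc (suc (c + c)) → 0 < q →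
              4 * (q * q) < suc k′ * P → B * suc c ≤ (q * q) * P ^ k′ → 2 * B ≤ P ^ suc k′
  few-heavy {k′} {q} {P} {c} {B} k≤2c+2 q>0 big bad =
    *-cancelʳ-≤ (2 * B) (P ^ suc k′) (2 * (q * q)) {{>-nonZero (*-monoʳ-< 2 (*-mono-< q>0 q>0))}} (begin
      2 * B * (2 * (q * q))       ≡⟨ identity₁ B (q * q) ⟩
      B * (4 * (q * q))           ≤⟨ *-monoʳ-≤ B (<⇒≤ big) ⟩
      B * (suc k′ * P)            ≤⟨ *-monoʳ-≤ B (*-monoˡ-≤ P k≤2c+2) ⟩
      B * (suc (suc (c + c)) * P) ≡⟨ identity₂ B c P ⟩
      2 * P * (B * suc c)         ≤⟨ *-monoʳ-≤ (2 * P) bad ⟩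
      2 * P * (q * q * P ^ k′)    ≡⟨ identity₃ P (q * q) (P ^ k′) ⟩
      P * P ^ k′ * (2 * (q * q))  ∎)
    where
      open ≤-Reasoning
      identity₁ : ∀ b x → 2 * b * (2 * x) ≡ b * (4 * x)
      identity₁ = solve-∀
      identity₂ : ∀ b c P → b * (suc (suc (c + c)) * P) ≡ 2 * P * (b * suc c)
      identity₂ = solve-∀
      identity₃ : ∀ P x y → 2 * P * (x * y) ≡ P * y * (2 * x)
      identity₃ = solve-∀

  majority : ∀ {G B s} → G + B ≡ s → 2 * B ≤ s → s ≤ 2 * G
  majority {G} {B} {s} G+B≡s 2B≤s = +-cancelʳ-≤ s s (2 * G) (begin
    s + s                 ≡⟨ cong (λ t → t + t) (sym G+B≡s) ⟩
    (G + B) + (G + B)     ≡⟨ identity G B ⟩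
    2 * G + 2 * B         ≤⟨ +-monoʳ-≤ (2 * G) 2B≤s ⟩
    2 * G + s             ∎)
    where open ≤-Reasoning
          identity : ∀ g b → (g + b) + (g + b) ≡ 2 * g + 2 * b
          identity = solve-∀

  below-square : ∀ {x P} → x < P → ∀ c → suc (x * x) ^ c ≤ P ^ (c + c)
  below-square x<P zero    = s≤s z≤n
  below-square {x} {P} x<P (suc c) = begin
    suc (x * x) * suc (x * x) ^ c ≤⟨ *-mono-≤ (*-mono-< x<P x<P) (below-square x<P c) ⟩
    P * P * P ^ (c + c)           ≡⟨ *-assoc P P (P ^ (c + c)) ⟩
    P ^ suc (suc (c + c))         ≡⟨ cong (λ t → P ^ suc t) (sym (+-suc c c)) ⟩
    P ^ (suc c + suc c)           ∎
    where open ≤-Reasoning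

  bound-from-counts : ∀ {P k′ q} → suc k′ ≤ q →
    (∀ c → ∃₂ λ G B → G + B ≡ P ^ suc k′ × B * suc c ≤ (q * q) * P ^ k′ × G ≤ suc (q * q) ^ c) →
    suc k′ * P ≤ 4 * (q * q)
  bound-from-counts {P} {k′} {q} k≤q counts with suc k′ * P ≤? 4 * (q * q)
  ... | yes small = small
  ... | no  ¬small with halves k′
  ...   | c , 2c≤k′ , k′≤2c+1 with counts c
  ...     | G , B , G+B≡s , bad , good = ⊥-elim (<-irrefl refl (begin-strict
    P ^ suc k′             ≤⟨ majority {G} {B} G+B≡s (few-heavy {k′} {q} {P} {c} {B} (s≤s k′≤2c+1) q>0 big bad) ⟩
    2 * G                  ≤⟨ *-monoʳ-≤ 2 (≤-trans good (below-square (≤-<-trans (m≤n*m q 4) 4q<P) c)) ⟩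
    2 * P ^ (c + c)        <⟨ *-monoˡ-< (P ^ (c + c)) {{>-nonZero (m^n>0 P (c + c))}} 2<P ⟩
    P * P ^ (c + c)        ≤⟨ ^-monoʳ-≤ P (s≤s 2c≤k′) ⟩
    P ^ suc k′             ∎))
    where
      open ≤-Reasoning
      big : 4 * (q * q) < suc k′ * P
      big = ≰⇒> ¬small
      q>0 : 0 < q
      q>0 = <-≤-trans (s≤s z≤n) k≤q
      4q<P : 4 * q < P
      4q<P = large-base k≤q big
      2<P : 2 < P
      2<P = <-trans (<-≤-trans (s≤s (s≤s (s≤s z≤n))) (*-monoʳ-≤ 4 q>0)) 4q<P
      instance
        P≢0 : NonZero P
        P≢0 = >-nonZero (<-trans (s≤s z≤n) 2<P)

open import Data.Nat using (_∸_; nonTrivial⇒n>1)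
open import Data.Nat.Primality using (prime⇒nonTrivial)
open import Data.Nat.Tactic.RingSolver using (solve-∀)
open Arithmetic

lower-bound : ∀ (p : ℕ) .{{_ : NonZero p}} → Prime p → ∀ k′ m N → 0 < m → p ^ m ≤ N →
              (alg : NonadaptiveAlg p (suc k′ + m) N) → Solves p (suc k′) alg →
              suc k′ ≤ q alg × suc k′ * p ^ m ≤ 4 * (q alg * q alg)
lower-bound p p-prime k′ m N m>0 pᵐ≤N alg solves = k≤q , subst (λ P → suc k′ * P ≤ 4 * (q alg * q alg)) P≡pᵐ kP≤4q²
  where
    P≡pᵐ : size (enumVec (enumFin p) m) ≡ p ^ m
    P≡pᵐ = size-enumVec (enumFin p) m
    open LowerBound p p-prime k′ m N alg solves (subst (_≤ N) (sym P≡pᵐ) pᵐ≤N)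
    1<P : 1 < P
    1<P = subst (1 <_) (sym P≡pᵐ) (ℕ.^-monoʳ-< p (nonTrivial⇒n>1 p {{prime⇒nonTrivial p-prime}}) m>0)
    k≤q : suc k′ ≤ q alg
    k≤q = rank≤queries 1<P
    kP≤4q² : suc k′ * P ≤ 4 * (q alg * q alg)
    kP≤4q² = bound-from-counts k≤q collision-counts

gsp-bounds : ∀ (p : ℕ) .{{_ : NonZero p}} → Prime p →
             ∀ (n k : ℕ) → 0 < k → k < n →
             ∀ (N : ℕ) → p ^ (n ∸ k) ≤ N →
             (alg : NonadaptiveAlg p n N) → Solves p k alg →
             k ≤ q alg × k * p ^ (n ∸ k) ≤ 4 * (q alg * q alg)
gsp-bounds p p-prime n (suc k′) _ k<n N pᵐ≤N = split (n ∸ suc k′) (ℕ.m+[n∸m]≡n (ℕ.<⇒≤ k<n)) (ℕ.m<n⇒0<n∸m k<n) pᵐ≤N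
  where
    split : ∀ m → suc k′ + m ≡ n → 0 < m → p ^ m ≤ N → (alg : NonadaptiveAlg p n N) → Solves p (suc k′) alg →
            suc k′ ≤ q alg × suc k′ * p ^ m ≤ 4 * (q alg * q alg)
    split m refl m>0 = lower-bound p p-prime k′ m N m>0

-- the theorem with C = 2: k ≤ q ≤ 2q and k p^(n-k) ≤ 4 q² = (2q)²
theorem2 : ∃ λ C → 0 < C × (∀ (p : ℕ) .{{_ : NonZero p}} → Prime p →
    ∀ (n k : ℕ) → 0 < k → k < n →
    ∀ (m : ℕ) → p ^ (n ∸ k) ≤ m →
    (A : NonadaptiveAlg p n m) → Solves p k A →
    k ≤ C * q A
    × k * p ^ (n ∸ k) ≤ (C * q A) * (C * q A))
theorem2 = 2 , s≤s z≤n , λ p p-prime n k k>0 k<n N pᵐ≤N alg solves →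
  let k≤q , kP≤4q² = gsp-bounds p p-prime n k k>0 k<n N pᵐ≤N alg solves
  in ℕ.≤-trans k≤q (ℕ.m≤n*m (q alg) 2) , subst (k * p ^ (n ∸ k) ≤_) (four-square (q alg)) kP≤4q²
  where
    four-square : ∀ x → 4 * (x * x) ≡ (2 * x) * (2 * x)
    four-square = solve-∀
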